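{- Let $G=(V,E)$ be a connected simple graph, let $S\subseteq V$ be a mixed resolving set of $G$, and let $x\in S$ be arbitrary. Then $|S| \geq 1 + \lceil \log_2 (1+\deg_x) \rceil$, where $\deg_x$ is the degree of $x$ in $G$.
   Context: For vertices $u,v$, $d(u,v)$ is the number of edges on a shortest $u$–$v$ path. For a vertex $w$ and an edge $e=uv$, $d(w,e)=\min(d(w,u),d(w,v))$. A vertex $w$ resolves two elements $x,y\in V\cup E$ if $d(w,x)\neq d(w,y)$. A set $S\subseteq V$ is a mixed resolving set if every pair of distinct elements of $V\cup E$ is resolved by some element of $S$. -}

module Defs where

open import Data.Nat using (ℕ; zero; suc; _≤_; _⊓_)
open import Data.Fin using (Fin)
open import Data.Bool using (Bool; true; false; T)
open import Data.Vec using (countᵇ; allFin)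
open import Data.Product using (Σ; ∃; ∃-syntax; _×_; _,_)
open import Data.Sum using (_⊎_)
open import Relation.Binary.PropositionalEquality using (_≡_; _≢_)
open import Relation.Nullary using (¬_)
open import Data.Empty using (⊥)
open import Data.Fin.Subset using (Subset; _∈_)

record Graph (n : ℕ) : Set where
  field
    adj     : Fin n → Fin n → Bool
    sym     : ∀ u v → adj u v ≡ adj v u
    irrefl  : ∀ u → adj u u ≡ false

open Graph public

Adj : ∀ {n} → Graph n → Fin n → Fin n → Set
Adj G u v = T (adj G u v)

data Walk {n : ℕ} (G : Graph n) : Fin n → Fin n → ℕ → Set where
  here : ∀ {u} → Walk G u u zero
  step : ∀ {u v w k} → Adj G u v → Walk G v w k → Walk G u w (suc k)

Connected : ∀ {n} → Graph n → Set
Connected G = ∀ u v → ∃[ k ] Walk G u v k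

Dist : ∀ {n} → Graph n → Fin n → Fin n → ℕ → Set
Dist G u v k = Walk G u v k × (∀ m → Walk G u v m → k ≤ m)

deg : ∀ {n} → Graph n → Fin n → ℕ
deg {n} G x = countᵇ (adj G x) (allFin n)

-- Elements of V ∪ E.  An edge is given by an ordered adjacent pair; the
-- pairs (u,v) and (v,u) denote the same edge (see SameElem).
data Elem {n : ℕ} (G : Graph n) : Set where
  vert : Fin n → Elem G
  edge : (u v : Fin n) → Adj G u v → Elem G

SameElem : ∀ {n} {G : Graph n} → Elem G → Elem G → Set
SameElem (vert u) (vert v) = u ≡ v
SameElem (vert _) (edge _ _ _) = ⊥
SameElem (edge _ _ _) (vert _) = ⊥
SameElem (edge u v _) (edge u′ v′ _) = (u ≡ u′ × v ≡ v′) ⊎ (u ≡ v′ × v ≡ u′)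

DistE : ∀ {n} (G : Graph n) → Fin n → Elem G → ℕ → Set
DistE G w (vert v) k = Dist G w v k
DistE G w (edge u v _) k = ∃[ a ] ∃[ b ] (Dist G w u a × Dist G w v b × k ≡ a ⊓ b)

Resolves : ∀ {n} (G : Graph n) → Fin n → Elem G → Elem G → Set
Resolves G w x y = ∀ a b → DistE G w x a → DistE G w y b → a ≢ b

MixedResolving : ∀ {n} (G : Graph n) → Subset n → Set
MixedResolving {n} G S =
  ∀ (x y : Elem G) → ¬ SameElem x y → ∃[ w ] (w ∈ S × Resolves G w x y)

module Submission where

-- Fix x ∈ S and list the "closed star" of x: the vertex x itself
-- and the edges xv for the deg(x) neighbours v of x.  For a vertex w, every v
-- adjacent to x satisfies d(w,v) ≥ d(w,x) - 1, hence d(w,xv) = min(d(w,x), d(w,v))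
-- is either d(w,x) - 1 or d(w,x), and d(w,x) is the value on x itself.  So on the
-- star, w sees only one bit of information: "is this element strictly closer to
-- w than x is?".  The vertex x sees distance 0 everywhere on its star.  Hence
-- the 1 + deg(x) pairwise distinct star elements are separated by the bits of
-- the vertices of S - {x}, and a family separated by the bits of an m-element
-- set has at most 2^m members.

open import Defs hiding (sym)
open import Data.Nat using (ℕ; zero; suc; _≤_; _+_; _∸_; _⊓_; _^_; _<ᵇ_; z≤n; s≤s)
open import Data.Nat.Properties
  using (+-mono-≤; +-identityʳ; +-suc; ≤-antisym; <ᵇ-reflects-<; <⇒≤; ≮⇒≥; n≤0⇒n≡0; m≤n⇒m⊓n≡m; m≥n⇒m⊓n≡n;
         module ≤-Reasoning)
open import Data.Nat.Logarithm using (⌈log₂_⌉; ⌈log₂⌉-mono-≤; ⌈log₂2^n⌉≡n)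
open import Data.Fin using (Fin; zero; suc; _≟_)
open import Data.Fin.Properties using (any?; suc-injective)
open import Data.Fin.Subset using (Subset; _∈_; ∣_∣; _-_; inside; outside)
open import Data.Fin.Subset.Properties using (x∈p∧x≢y⇒x∈p-y; x∈p⇒∣p-x∣<∣p∣)
open import Data.Vec using ([]; _∷_; countᵇ; tabulate; there)
open import Data.Bool using (Bool; true; false; T; _∧_; not; if_then_else_)
open import Data.Bool.Properties using (T?; T-∧; T-≡; T-not-≡)
open import Data.Product using (∃-syntax; _×_; _,_; proj₁; proj₂)
open import Data.Sum using (inj₁; inj₂)
open import Data.Empty using (⊥-elim)
open import Function using (_∘_; id)
open import Function.Bundles using (Equivalence)
open import Relation.Nullary using (¬_; Dec; yes; no)
open import Relation.Nullary.Reflects using (ofʸ; ofⁿ)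
open import Relation.Nullary.Decidable using (_×-dec_)
open import Relation.Binary.PropositionalEquality
  using (_≡_; _≢_; refl; sym; trans; cong; subst)

open Equivalence using (to)

count : ∀ {k} → (Fin k → Bool) → ℕ
count {zero}  A = 0
count {suc k} A = (if A zero then 1 else 0) + count (A ∘ suc)

countᵇ-tabulate : ∀ {k} {B : Set} (p : B → Bool) (f : Fin k → B) →
                  countᵇ p (tabulate f) ≡ count (p ∘ f)
countᵇ-tabulate {zero}  p f = refl
countᵇ-tabulate {suc k} p f with p (f zero)
... | true  = cong suc (countᵇ-tabulate p (f ∘ suc))
... | false = countᵇ-tabulate p (f ∘ suc)

count-split : ∀ {k} (A B : Fin k → Bool) →
              count A ≡ count (λ i → A i ∧ B i) + count (λ i → A i ∧ not (B i))
count-split {zero}  A B = refl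
count-split {suc k} A B with A zero | B zero
... | true  | true  = cong suc (count-split (A ∘ suc) (B ∘ suc))
... | true  | false = trans (cong suc (count-split (A ∘ suc) (B ∘ suc)))
                           (sym (+-suc _ _))
... | false | _     = count-split (A ∘ suc) (B ∘ suc)

count-none : ∀ {k} (A : Fin k → Bool) → (∀ i → ¬ T (A i)) → count A ≡ 0
count-none {zero}  A none = refl
count-none {suc k} A none with A zero | none zero
... | true  | ¬A0 = ⊥-elim (¬A0 _)
... | false | _   = count-none (A ∘ suc) (none ∘ suc)

count-subsingleton : ∀ {k} (A : Fin k → Bool) →
                     (∀ u v → T (A u) → T (A v) → u ≡ v) → count A ≤ 1
count-subsingleton {zero}  A unique = z≤n
count-subsingleton {suc k} A unique with A zero in A0
... | true  = s≤s (subst (_≤ 0) (sym rest-empty) z≤n)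
  where
  rest-empty : count (A ∘ suc) ≡ 0
  rest-empty = count-none (A ∘ suc) λ i Ai → zero≢suc (unique zero (suc i) (subst T (sym A0) _) Ai)
    where
    zero≢suc : ∀ {i : Fin k} → ¬ zero ≡ suc i
    zero≢suc ()
... | false = count-subsingleton (A ∘ suc)
                λ u v Au Av → suc-injective (unique (suc u) (suc v) Au Av)

Separated : ∀ {n k} → Subset n → (Fin n → Fin k → Bool) → (Fin k → Bool) → Set
Separated W code A =
  ∀ u v → T (A u) → T (A v) → u ≢ v → ∃[ w ] (w ∈ W × code w u ≢ code w v)

separated-mono : ∀ {n k} {W : Subset n} {code : Fin n → Fin k → Bool} {A A′ : Fin k → Bool} →
                 (∀ i → T (A′ i) → T (A i)) → Separated W code A → Separated W code A′
separated-mono sub sep u v A′u A′v = sep u v (sub u A′u) (sub v A′v)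

separated-outside : ∀ {n k} {W : Subset n} {code : Fin (suc n) → Fin k → Bool} {A : Fin k → Bool} →
                    Separated (outside ∷ W) code A → Separated W (code ∘ suc) A
separated-outside sep u v Au Av u≢v with sep u v Au Av u≢v
... | suc w , there w∈W , differ = w , w∈W , differ

separated-tail : ∀ {n k} {s} {W : Subset n} {code : Fin (suc n) → Fin k → Bool} {A : Fin k → Bool} →
                 (∀ u v → T (A u) → T (A v) → code zero u ≡ code zero v) →
                 Separated (s ∷ W) code A → Separated W (code ∘ suc) A
separated-tail constant sep u v Au Av u≢v with sep u v Au Av u≢v
... | zero  , _          , differ = ⊥-elim (differ (constant u v Au Av))
... | suc w , there w∈W , differ = w , w∈W , differ

separated-by-none : ∀ {k} {code : Fin 0 → Fin k → Bool} {A : Fin k → Bool} →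
                    Separated [] code A → count A ≤ 1
separated-by-none {A = A} sep = count-subsingleton A equal
  where
  equal : ∀ u v → T (A u) → T (A v) → u ≡ v
  equal u v Au Av with u ≟ v
  ... | yes u≡v = u≡v
  ... | no u≢v with sep u v Au Av u≢v
  ... | () , _

-- The counting bound: a family separated by the codes of W has at most 2^|W|
-- members.  Induction on W: a coordinate in W splits the family into two
-- classes on which it is constant.
separated-count : ∀ {n k} (W : Subset n) (code : Fin n → Fin k → Bool) (A : Fin k → Bool) →
                  Separated W code A → count A ≤ 2 ^ ∣ W ∣
separated-count []            code A sep = separated-by-none sep
separated-count (outside ∷ W) code A sep =
  separated-count W (code ∘ suc) A (separated-outside sep)
separated-count (inside ∷ W)  code A sep = begin
    count A                   ≡⟨ count-split A (code zero) ⟩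
    count A₁ + count A₀       ≤⟨ +-mono-≤ (separated-count W (code ∘ suc) A₁ sep₁)
                                          (separated-count W (code ∘ suc) A₀ sep₀) ⟩
    2 ^ ∣ W ∣ + 2 ^ ∣ W ∣      ≡⟨ cong (2 ^ ∣ W ∣ +_) (sym (+-identityʳ _)) ⟩
    2 ^ ∣ inside ∷ W ∣        ∎
  where
  open ≤-Reasoning
  A₁ A₀ : Fin _ → Bool
  A₁ = λ i → A i ∧ code zero i
  A₀ = λ i → A i ∧ not (code zero i)
  sep₁ : Separated W (code ∘ suc) A₁
  sep₁ = separated-tail
    (λ u v A₁u A₁v → trans (to T-≡ (proj₂ (to T-∧ A₁u))) (sym (to T-≡ (proj₂ (to T-∧ A₁v)))))
    (separated-mono (λ i → proj₁ ∘ to T-∧) sep)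
  sep₀ : Separated W (code ∘ suc) A₀
  sep₀ = separated-tail
    (λ u v A₀u A₀v → trans (to T-not-≡ (proj₂ (to T-∧ A₀u))) (sym (to T-not-≡ (proj₂ (to T-∧ A₀v)))))
    (separated-mono (λ i → proj₁ ∘ to T-∧) sep)

least-witness : (R : ℕ → Set) → (∀ k → Dec (R k)) → ∀ K → R K →
                ∃[ k ] (R k × (∀ m → R m → k ≤ m))
least-witness R R? K RK with R? 0
... | yes R0 = 0 , R0 , λ _ _ → z≤n
least-witness R R? zero    RK | no ¬R0 = ⊥-elim (¬R0 RK)
least-witness R R? (suc K) RK | no ¬R0 with least-witness (R ∘ suc) (R? ∘ suc) K RK
... | k , Rk , least = suc k , Rk , below
  where
  below : ∀ m → R m → suc k ≤ m
  below zero    R0 = ⊥-elim (¬R0 R0)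
  below (suc m) Rm = s≤s (least m Rm)

module _ {n : ℕ} (G : Graph n) where

  adj-sym : ∀ {u v} → Adj G u v → Adj G v u
  adj-sym {u} {v} = subst T (Graph.sym G u v)

  no-loop : ∀ {u} → ¬ Adj G u u
  no-loop {u} a with subst T (irrefl G u) a
  ... | ()

  walk-snoc : ∀ {u v y k} → Walk G u v k → Adj G v y → Walk G u y (suc k)
  walk-snoc here       a = step a here
  walk-snoc (step b w) a = step b (walk-snoc w a)

  walk? : ∀ k u v → Dec (Walk G u v k)
  walk? zero u v with u ≟ v
  ... | yes refl = yes here
  ... | no u≢v   = no λ { here → u≢v refl }
  walk? (suc k) u v with any? (λ m → T? (adj G u m) ×-dec walk? k m v)
  ... | yes (m , a , w) = yes (step a w)
  ... | no ¬w           = no λ { (step a w) → ¬w (_ , a , w) }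

  shortest : Connected G → ∀ u v → ∃[ k ] Dist G u v k
  shortest conn u v with conn u v
  ... | K , w = least-witness (Walk G u v) (λ k → walk? k u v) K w

  dist-neighbour : ∀ {w u v D d} → Dist G w u D → Dist G w v d → Adj G u v → D ≤ suc d
  dist-neighbour Du Dv a = proj₂ Du _ (walk-snoc (proj₁ Dv) (adj-sym a))

⊓-of-neighbour : ∀ D d → D ≤ suc d → D ⊓ d ≡ (if d <ᵇ D then D ∸ 1 else D)
⊓-of-neighbour D d D≤1+d with d <ᵇ D | <ᵇ-reflects-< d D
... | true  | ofʸ d<D = trans (m≥n⇒m⊓n≡n (<⇒≤ d<D)) (cong (_∸ 1) (≤-antisym d<D D≤1+d))
... | false | ofⁿ d≮D = m≤n⇒m⊓n≡m (≮⇒≥ d≮D)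

module Star {n : ℕ} (G : Graph n) (conn : Connected G) (x : Fin n) where

  dist : Fin n → Fin n → ℕ
  dist u v = proj₁ (shortest G conn u v)

  dist-spec : ∀ u v → Dist G u v (dist u v)
  dist-spec u v = proj₂ (shortest G conn u v)

  dist-self : ∀ u → dist u u ≡ 0
  dist-self u = n≤0⇒n≡0 (proj₂ (dist-spec u u) 0 here)

  -- Index zero stands for the vertex x, index suc v for the edge xv.
  inStar : Fin (suc n) → Bool
  inStar zero    = true
  inStar (suc v) = adj G x v

  starElem : (i : Fin (suc n)) → T (inStar i) → Elem G
  starElem zero    _  = vert x
  starElem (suc v) xv = edge x v xv

  starBit : Fin n → Fin (suc n) → Bool
  starBit w zero    = false
  starBit w (suc v) = dist w v <ᵇ dist w x

  starValue : Fin n → Fin (suc n) → ℕ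
  starValue w i = if starBit w i then dist w x ∸ 1 else dist w x

  star-dist : ∀ w i (a : T (inStar i)) → DistE G w (starElem i a) (starValue w i)
  star-dist w zero    _  = dist-spec w x
  star-dist w (suc v) xv =
    dist w x , dist w v , dist-spec w x , dist-spec w v ,
    sym (⊓-of-neighbour _ _ (dist-neighbour G (dist-spec w x) (dist-spec w v) xv))

  starValue-centre : ∀ i → starValue x i ≡ 0
  starValue-centre i with starBit x i
  ... | true  = cong (_∸ 1) (dist-self x)
  ... | false = dist-self x

  star-distinct : ∀ i j (a : T (inStar i)) (b : T (inStar j)) → i ≢ j →
                  ¬ SameElem (starElem i a) (starElem j b)
  star-distinct zero    zero    _ _  i≢j _  = i≢j refl
  star-distinct zero    (suc v) _ _  _   ()
  star-distinct (suc u) zero    _ _  _   ()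
  star-distinct (suc u) (suc v) _ _  i≢j (inj₁ (_ , u≡v)) = i≢j (cong suc u≡v)
  star-distinct (suc u) (suc v) _ xv _   (inj₂ (x≡v , _)) =
    no-loop G (subst (Adj G x) (sym x≡v) xv)

  -- In a mixed resolving set S, the star is separated by the bits of S - x:
  -- x resolves no two star elements, and any other vertex resolves two of them
  -- only if its bits differ.
  star-separated : ∀ {S} → MixedResolving G S → Separated (S - x) starBit inStar
  star-separated mr i j a b i≢j with mr (starElem i a) (starElem j b) (star-distinct i j a b i≢j)
  ... | w , w∈S , resolves = w , x∈p∧x≢y⇒x∈p-y w∈S w≢x , bits-differ
    where
    values-differ : starValue w i ≢ starValue w j
    values-differ = resolves _ _ (star-dist w i a) (star-dist w j b)
    w≢x : w ≢ x
    w≢x refl = values-differ (trans (starValue-centre i) (sym (starValue-centre j)))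
    bits-differ : starBit w i ≢ starBit w j
    bits-differ same = values-differ (cong (λ β → if β then dist w x ∸ 1 else dist w x) same)

theorem2 : ∀ {n : ℕ} (G : Graph n) → Connected G → (S : Subset n) → MixedResolving G S →
           (x : Fin n) → x ∈ S → 1 + ⌈log₂ (1 + deg G x) ⌉ ≤ ∣ S ∣
theorem2 G conn S mr x x∈S = begin
    1 + ⌈log₂ (1 + deg G x) ⌉      ≡⟨ cong (λ d → 1 + ⌈log₂ (1 + d) ⌉) (countᵇ-tabulate (adj G x) id) ⟩
    1 + ⌈log₂ (count inStar) ⌉     ≤⟨ s≤s (⌈log₂⌉-mono-≤ star-bound) ⟩
    1 + ⌈log₂ (2 ^ ∣ S - x ∣) ⌉    ≡⟨ cong suc (⌈log₂2^n⌉≡n ∣ S - x ∣) ⟩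
    1 + ∣ S - x ∣                  ≤⟨ x∈p⇒∣p-x∣<∣p∣ x∈S ⟩
    ∣ S ∣                          ∎
  where
  open ≤-Reasoning
  open Star G conn x
  star-bound : count inStar ≤ 2 ^ ∣ S - x ∣
  star-bound = separated-count (S - x) starBit inStar (star-separated mr)
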